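{- For $n\ge1$, $$d(n,1)=\begin{cases}\left(\frac{n-1}{2}\right)!^{\,2}, & n\text{ odd},\\[2pt] \frac n2\cdot\left(\frac{n-2}{2}\right)!^{\,2}, & n\text{ even},\end{cases}\qquad d(n,n-1)=\lfloor n/2\rfloor\cdot\lceil n/2\rceil,$$ and for $n\ge0$, $r(n)=d(n+2,1)$, where $r(n)=\sum_{k=0}^nd(n,k)$.
   Context: The staircase board of length $n$ consists of squares $(i,j)$, $i,j\ge1$, $i+j\le n$ (row $i$ from the top, column $j$ from the left; column $j$ has $n-j$ squares). Square $(i,j)$ has $n-i-j$ squares below it in its column and is shaded if $n-i-j$ is even. $\mathcal{AR}(n,r)$ is the set of placements of $r$ rooks on shaded squares of the staircase board of length $n$ with no two rooks in the same column. $d(n,k)=|\mathcal{AR}(n,n-k)|$ (with $d(0,0)=1$ and $d(n,k)=0$ for $k>n$). -}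

module Defs where

open import Data.Nat.Base using (ℕ; zero; suc; _+_; _*_; _∸_; _≡ᵇ_; _≤ᵇ_; _%_)
open import Data.Bool.Properties using (T?)
open import Data.Bool.Base using (Bool; true; false; _∧_; not; if_then_else_)
open import Data.Product.Base using (_×_; _,_; proj₂)
open import Data.List.Base using (List; []; _∷_; length; filter; concatMap; map; applyUpTo; _++_)

-- A square (i , j) : row i (from the top), column j (from the left).
Square : Set
Square = ℕ × ℕ

col : Square → ℕ
col (_ , j) = j

-- All squares (i,j) with i,j ≥ 1 and i + j ≤ n, i.e. column j (1 ≤ j ≤ n-1)
-- contains the rows 1 .. n-j.
squares : ℕ → List Square
squares n = concatMap (λ j → applyUpTo (λ i → (suc i , j)) (n ∸ j)) (applyUpTo suc (n ∸ 1))

-- (i,j) is shaded iff the number n-i-j of squares below it in its column is even.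
shaded : ℕ → Square → Bool
shaded n (i , j) = ((n ∸ i ∸ j) % 2) ≡ᵇ 0

shadedSquares : ℕ → List Square
shadedSquares n = filter (λ s → T? (shaded n s)) (squares n)

subsets : {A : Set} → List A → List (List A)
subsets [] = [] ∷ []
subsets (x ∷ xs) = subsets xs ++ map (x ∷_) (subsets xs)

notInCol : ℕ → List Square → Bool
notInCol j [] = true
notInCol j (t ∷ ts) = not (j ≡ᵇ col t) ∧ notInCol j ts

distinctCols : List Square → Bool
distinctCols [] = true
distinctCols (s ∷ ss) = notInCol (col s) ss ∧ distinctCols ss

-- AR(n,r): placements of r rooks on shaded squares, no two in the same column,
-- listed as the subsets of the set of shaded squares of size r with distinct columns.
AR : ℕ → ℕ → List (List Square)
AR n r = filter (λ p → T? ((length p ≡ᵇ r) ∧ distinctCols p)) (subsets (shadedSquares n))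

d : ℕ → ℕ → ℕ
d n k = if k ≤ᵇ n then length (AR n (n ∸ k)) else 0

sumUpTo : ℕ → (ℕ → ℕ) → ℕ
sumUpTo zero f = f 0
sumUpTo (suc m) f = sumUpTo m f + f (suc m)

r : ℕ → ℕ
r n = sumUpTo n (d n)

module Submission where

-- Column j of the staircase board (1 ≤ j ≤ n-1) has n-j squares, and exactly
-- ⌈(n-j)/2⌉ of them are shaded.  A placement of r rooks in distinct columns
-- chooses r columns and one shaded square in each, hence
--     |AR(n,r)| = e_r(⌈(n-1)/2⌉, …, ⌈2/2⌉, ⌈1/2⌉) = e_r(halfCeils (n-1)),
-- the r-th elementary symmetric function of the column sizes.  The theorem is
-- then a set of identities about this list:
--   * d(n,1)   = e_{n-1} = product of the list, a product of two factorials;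
--   * d(n,n-1) = e_1     = sum of the list = ⌊n/2⌋⌈n/2⌉;
--   * r(n)     = Σ_r e_r = ∏ (1 + ⌈m/2⌉) = ∏_{m ≤ n+1} ⌈m/2⌉ = d(n+2,1).

open import Defs
open import Data.Nat.Base using (ℕ; suc; _+_; _*_; _∸_; _/_; _%_; _≤_; _!; ⌊_/2⌋; ⌈_/2⌉)
open import Data.Product.Base using (_×_)
open import Relation.Binary.PropositionalEquality using (_≡_)

open import Data.Nat.Base using (zero; _≡ᵇ_; _<_; s≤s; z≤n)
open import Data.Nat.Properties
  using (+-identityʳ; +-assoc; +-comm; *-comm; *-suc; *-identityʳ; ≤-refl; n≤1+n;
         m≤n⇒m≤1+n; <-irrefl; suc-injective; ≤⇒≤ᵇ; ≡ᵇ⇒≡; ≡⇒≡ᵇ; ∸-+-assoc; +-∸-assoc;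
         n∸n≡0; m∸n≤m; m+n∸n≡m)
open import Data.Nat.DivMod using (m≡m%n+[m/n]*n; m*n/n≡m; [m+n]%n≡m%n)
open import Data.Nat.Tactic.RingSolver using (solve-∀)
open import Data.Bool.Base using (Bool; true; false; _∧_; _∨_; not; if_then_else_)
open import Data.Bool.Properties using (T?; T-≡; ∧-zeroʳ; ∧-identityʳ; if-float)
open import Data.Empty using (⊥-elim)
open import Data.Product.Base using (_,_)
open import Data.List.Base
  using (List; []; _∷_; length; filter; concatMap; map; applyUpTo; applyDownFrom; _++_)
open import Data.Nat.ListAction using (sum; product)
open import Data.List.Properties using (filter-++; map-cong; map-applyUpTo; length-applyDownFrom)
open import Data.List.Relation.Unary.All using (All; []; _∷_) renaming (map to All-map)
open import Data.List.Relation.Unary.All.Properties using (concat⁺; map⁺; filter⁺; applyUpTo⁺₂)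
open import Data.List.Relation.Unary.AllPairs using (_∷_)
open import Data.List.Relation.Unary.Unique.Propositional using (Unique)
open import Data.List.Relation.Unary.Unique.Propositional.Properties using (applyUpTo⁺₁)
open import Function.Bundles using (Equivalence)
open import Relation.Binary.PropositionalEquality using (_≢_; refl; sym; trans; cong; cong₂; subst; module ≡-Reasoning)
open ≡-Reasoning

count : {A : Set} → (A → Bool) → List A → ℕ
count b []       = 0
count b (x ∷ xs) = if b x then suc (count b xs) else count b xs

length-filter≡count : {A : Set} (b : A → Bool) (xs : List A) →
                      length (filter (λ x → T? (b x)) xs) ≡ count b xs
length-filter≡count b []       = refl
length-filter≡count b (x ∷ xs) with b x
... | true  = cong suc (length-filter≡count b xs)
... | false = length-filter≡count b xs

count-++ : {A : Set} (b : A → Bool) (xs ys : List A) → count b (xs ++ ys) ≡ count b xs + count b ys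
count-++ b []       ys = refl
count-++ b (x ∷ xs) ys =
  trans (cong (λ c → if b x then suc c else c) (count-++ b xs ys)) (sym (if-float (_+ count b ys) (b x)))

count-map : {A B : Set} (b : B → Bool) (f : A → B) (xs : List A) → count b (map f xs) ≡ count (λ x → b (f x)) xs
count-map b f []       = refl
count-map b f (x ∷ xs) = cong (λ c → if b (f x) then suc c else c) (count-map b f xs)

count-cong : {A : Set} {b b′ : A → Bool} → (∀ x → b x ≡ b′ x) → (xs : List A) → count b xs ≡ count b′ xs
count-cong h []                   = refl
count-cong {b′ = b′} h (x ∷ xs) rewrite h x = cong (λ c → if b′ x then suc c else c) (count-cong h xs)

count-false : {A : Set} (xs : List A) → count (λ _ → false) xs ≡ 0
count-false []       = refl
count-false (x ∷ xs) = count-false xs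

count-applyUpTo : {A B : Set} {b : A → Bool} {b′ : B → Bool} (f : ℕ → A) (g : ℕ → B) →
                  (∀ i → b (f i) ≡ b′ (g i)) → ∀ m → count b (applyUpTo f m) ≡ count b′ (applyUpTo g m)
count-applyUpTo f g h zero = refl
count-applyUpTo {b′ = b′} f g h (suc m) rewrite h 0 =
  cong (λ c → if b′ (g 0) then suc c else c) (count-applyUpTo (λ i → f (suc i)) (λ i → g (suc i)) (λ i → h (suc i)) m)

sumUpTo-cong : ∀ N (f g : ℕ → ℕ) → (∀ k → k ≤ N → f k ≡ g k) → sumUpTo N f ≡ sumUpTo N g
sumUpTo-cong zero    f g h = h 0 z≤n
sumUpTo-cong (suc N) f g h = cong₂ _+_ (sumUpTo-cong N f g (λ k k≤N → h k (m≤n⇒m≤1+n k≤N))) (h (suc N) ≤-refl)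

sumUpTo-first : ∀ N f → sumUpTo (suc N) f ≡ f 0 + sumUpTo N (λ k → f (suc k))
sumUpTo-first zero    f = refl
sumUpTo-first (suc N) f = trans (cong (_+ f (suc (suc N))) (sumUpTo-first N f)) (+-assoc (f 0) _ _)

sumUpTo-reverse : ∀ N f → sumUpTo N (λ k → f (N ∸ k)) ≡ sumUpTo N f
sumUpTo-reverse zero    f = refl
sumUpTo-reverse (suc N) f = begin
  sumUpTo N (λ k → f (suc N ∸ k)) + f (suc N ∸ suc N)
    ≡⟨ cong₂ _+_ (sumUpTo-cong N _ _ (λ k k≤N → cong f (+-∸-assoc 1 k≤N))) (cong f (n∸n≡0 N)) ⟩
  sumUpTo N (λ k → f (suc (N ∸ k))) + f 0
    ≡⟨ cong (_+ f 0) (sumUpTo-reverse N (λ k → f (suc k))) ⟩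
  sumUpTo N (λ k → f (suc k)) + f 0
    ≡⟨ +-comm _ (f 0) ⟩
  f 0 + sumUpTo N (λ k → f (suc k))
    ≡⟨ sym (sumUpTo-first N f) ⟩
  sumUpTo (suc N) f ∎

sumUpTo-linear : ∀ N (g h : ℕ → ℕ) c → sumUpTo N (λ k → g k + c * h k) ≡ sumUpTo N g + c * sumUpTo N h
sumUpTo-linear zero    g h c = refl
sumUpTo-linear (suc N) g h c =
  trans (cong (_+ (g (suc N) + c * h (suc N))) (sumUpTo-linear N g h c))
        (regroup (sumUpTo N g) (sumUpTo N h) (g (suc N)) (h (suc N)) c)
  where
  regroup : ∀ a b x y c → (a + c * b) + (x + c * y) ≡ (a + x) + c * (b + y)
  regroup = solve-∀

-- Elementary symmetric functions

-- e r cs : the sum, over all r-element sublists of cs, of the product of their entries.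
e : ℕ → List ℕ → ℕ
e zero    _        = 1
e (suc r) []       = 0
e (suc r) (c ∷ cs) = e (suc r) cs + c * e r cs

e-beyond-length : ∀ r cs → length cs < r → e r cs ≡ 0
e-beyond-length (suc r) []       _         = refl
e-beyond-length (suc r) (c ∷ cs) (s≤s lt) =
  trans (cong₂ _+_ (e-beyond-length (suc r) cs (m≤n⇒m≤1+n lt)) (cong (c *_) (e-beyond-length r cs lt)))
        (*-comm c 0)

e-length : ∀ cs → e (length cs) cs ≡ product cs
e-length []       = refl
e-length (c ∷ cs) = cong₂ _+_ (e-beyond-length (suc (length cs)) cs ≤-refl) (cong (c *_) (e-length cs))

e-one : ∀ cs → e 1 cs ≡ sum cs
e-one []       = refl
e-one (c ∷ cs) = trans (cong₂ _+_ (e-one cs) (*-identityʳ c)) (+-comm (sum cs) c)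

sum-e : ∀ cs N → length cs ≤ N → sumUpTo N (λ r → e r cs) ≡ product (map suc cs)
sum-e []       N       _         = sum-e-[] N
  where
  sum-e-[] : ∀ N → sumUpTo N (λ r → e r []) ≡ 1
  sum-e-[] zero    = refl
  sum-e-[] (suc N) = trans (+-identityʳ _) (sum-e-[] N)
sum-e (c ∷ cs) (suc N) (s≤s ≤N) = begin
  sumUpTo (suc N) (λ r → e r (c ∷ cs))
    ≡⟨ sumUpTo-first N _ ⟩
  1 + sumUpTo N (λ r → e (suc r) cs + c * e r cs)
    ≡⟨ cong (1 +_) (sumUpTo-linear N (λ r → e (suc r) cs) (λ r → e r cs) c) ⟩
  1 + (sumUpTo N (λ r → e (suc r) cs) + c * sumUpTo N (λ r → e r cs))
    ≡⟨ sym (+-assoc 1 (sumUpTo N (λ r → e (suc r) cs)) (c * sumUpTo N (λ r → e r cs))) ⟩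
  (1 + sumUpTo N (λ r → e (suc r) cs)) + c * sumUpTo N (λ r → e r cs)
    ≡⟨ cong (_+ c * sumUpTo N (λ r → e r cs)) (sym (sumUpTo-first N (λ r → e r cs))) ⟩
  sumUpTo (suc N) (λ r → e r cs) + c * sumUpTo N (λ r → e r cs)
    ≡⟨ cong₂ (λ a b → a + c * b) (sum-e cs (suc N) (m≤n⇒m≤1+n ≤N)) (sum-e cs N ≤N) ⟩
  product (map suc (c ∷ cs)) ∎

-- Rook placements on a list of squares

-- A set of forbidden columns, as a Boolean predicate.
Columns : Set
Columns = ℕ → Bool

noColumns : Columns
noColumns _ = false

forbid : ℕ → Columns → Columns
forbid j C k = (j ≡ᵇ k) ∨ C k

forbid-self : ∀ j C → forbid j C j ≡ true
forbid-self j C = cong (_∨ C j) (Equivalence.to T-≡ (≡⇒≡ᵇ j j refl))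

forbid-other : ∀ j C k → j ≢ k → forbid j C k ≡ C k
forbid-other j C k j≢k with j ≡ᵇ k in eq
... | true  = ⊥-elim (j≢k (≡ᵇ⇒≡ j k (Equivalence.from T-≡ eq)))
... | false = refl

avoids : Columns → List Square → Bool
avoids C []       = true
avoids C (s ∷ ss) = not (C (col s)) ∧ avoids C ss

avoids-noColumns : ∀ p → avoids noColumns p ≡ true
avoids-noColumns []       = refl
avoids-noColumns (s ∷ ss) = avoids-noColumns ss

avoids-forbid : ∀ j C p → avoids (forbid j C) p ≡ notInCol j p ∧ avoids C p
avoids-forbid j C []       = refl
avoids-forbid j C (s ∷ ss) with j ≡ᵇ col s | C (col s)
... | true  | _     = refl
... | false | true  = sym (∧-zeroʳ _)
... | false | false = avoids-forbid j C ss

freeIn : Columns → List Square → Bool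
freeIn C p = avoids C p ∧ distinctCols p

freeIn-∷ : ∀ C s p → freeIn C (s ∷ p) ≡ not (C (col s)) ∧ freeIn (forbid (col s) C) p
freeIn-∷ C s p rewrite avoids-forbid (col s) C p = shuffle (not (C (col s))) (avoids C p) (notInCol (col s) p) (distinctCols p)
  where
  shuffle : ∀ c a n d → (c ∧ a) ∧ (n ∧ d) ≡ c ∧ ((n ∧ a) ∧ d)
  shuffle false a     n d = refl
  shuffle true  true  n d = cong (_∧ d) (sym (∧-identityʳ n))
  shuffle true  false n d = cong (_∧ d) (sym (∧-zeroʳ n))

placements : List Square → ℕ → Columns → ℕ
placements L r C = count (λ p → (length p ≡ᵇ r) ∧ freeIn C p) (subsets L)

placements-∷ : ∀ x L r C → placements (x ∷ L) r C ≡
               placements L r C + count (λ p → (length (x ∷ p) ≡ᵇ r) ∧ freeIn C (x ∷ p)) (subsets L)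
placements-∷ x L r C = trans (count-++ _ (subsets L) (map (x ∷_) (subsets L)))
                             (cong (placements L r C +_) (count-map _ (x ∷_) (subsets L)))

placements-zero : ∀ L C → placements L 0 C ≡ 1
placements-zero []      C = refl
placements-zero (x ∷ L) C =
  trans (placements-∷ x L 0 C) (cong₂ _+_ (placements-zero L C) (count-false (subsets L)))

placements-blocked : ∀ x L r C → C (col x) ≡ true → placements (x ∷ L) r C ≡ placements L r C
placements-blocked x L r C blocked =
  trans (placements-∷ x L r C)
        (trans (cong (placements L r C +_) (trans (count-cong never (subsets L)) (count-false (subsets L))))
               (+-identityʳ _))
  where
  never : ∀ p → (length (x ∷ p) ≡ᵇ r) ∧ freeIn C (x ∷ p) ≡ false
  never p rewrite freeIn-∷ C x p | blocked = ∧-zeroʳ _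

placements-free : ∀ x L r C → C (col x) ≡ false →
                  placements (x ∷ L) (suc r) C ≡ placements L (suc r) C + placements L r (forbid (col x) C)
placements-free x L r C free =
  trans (placements-∷ x L (suc r) C) (cong (placements L (suc r) C +_) (count-cong using-x (subsets L)))
  where
  using-x : ∀ p → (length p ≡ᵇ r) ∧ freeIn C (x ∷ p) ≡ (length p ≡ᵇ r) ∧ freeIn (forbid (col x) C) p
  using-x p = cong ((length p ≡ᵇ r) ∧_) (trans (freeIn-∷ C x p) (cong (λ b → not b ∧ freeIn (forbid (col x) C) p) free))

placements-blocked-prefix : ∀ B R r C → All (λ s → C (col s) ≡ true) B → placements (B ++ R) r C ≡ placements R r C
placements-blocked-prefix []      R r C []       = refl
placements-blocked-prefix (x ∷ B) R r C (h ∷ hs) =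
  trans (placements-blocked x (B ++ R) r C h) (placements-blocked-prefix B R r C hs)

placements-cong : ∀ L r C C′ → All (λ s → C (col s) ≡ C′ (col s)) L → placements L r C ≡ placements L r C′
placements-cong []      r       C C′ []       = refl
placements-cong (x ∷ L) zero    C C′ _        = trans (placements-zero (x ∷ L) C) (sym (placements-zero (x ∷ L) C′))
placements-cong (x ∷ L) (suc r) C C′ (h ∷ hs) with C′ (col x) in eq
... | true  = trans (placements-blocked x L (suc r) C h)
                    (trans (placements-cong L (suc r) C C′ hs) (sym (placements-blocked x L (suc r) C′ eq)))
... | false = trans (placements-free x L r C h)
                    (trans (cong₂ _+_ (placements-cong L (suc r) C C′ hs)
                                      (placements-cong L r _ _ (All-map (cong ((col x ≡ᵇ _) ∨_)) hs)))
                           (sym (placements-free x L r C′ eq)))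

-- A block B of squares all in column j, followed by squares R outside column j:
-- a placement uses at most one square of B, in |B| possible ways.
placements-column : ∀ j B R C → All (λ s → col s ≡ j) B → All (λ s → j ≢ col s) R → C j ≡ false →
                    ∀ r → placements (B ++ R) (suc r) C ≡ placements R (suc r) C + length B * placements R r C
placements-column j []            R C []           outside free r = sym (+-identityʳ _)
placements-column j ((i , .j) ∷ B) R C (refl ∷ inB) outside free r = begin
  placements ((i , j) ∷ B ++ R) (suc r) C
    ≡⟨ placements-free (i , j) (B ++ R) r C free ⟩
  placements (B ++ R) (suc r) C + placements (B ++ R) r (forbid j C)
    ≡⟨ cong₂ _+_ (placements-column j B R C inB outside free r) rest-after-B ⟩
  (placements R (suc r) C + length B * m) + m
    ≡⟨ +-assoc _ (length B * m) m ⟩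
  placements R (suc r) C + (length B * m + m)
    ≡⟨ cong (placements R (suc r) C +_) (+-comm (length B * m) m) ⟩
  placements R (suc r) C + length ((i , j) ∷ B) * m ∎
  where
  m = placements R r C
  rest-after-B : placements (B ++ R) r (forbid j C) ≡ m
  rest-after-B =
    trans (placements-blocked-prefix B R r (forbid j C)
             (All-map (λ cs≡j → subst (λ k → forbid j C k ≡ true) (sym cs≡j) (forbid-self j C)) inB))
          (placements-cong R r (forbid j C) C (All-map (forbid-other j C _) outside))

-- Product rule: if the squares come in blocks B j, one for each column j of a
-- list js of distinct columns, then placing r rooks amounts to choosing r of
-- the columns and one square of each chosen block.
placements-by-columns : (B : ℕ → List Square) → (∀ j → All (λ s → col s ≡ j) (B j)) →
                        ∀ js → Unique js → ∀ r →
                        placements (concatMap B js) r noColumns ≡ e r (map (λ j → length (B j)) js)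
placements-by-columns B inB js       _           zero    = placements-zero (concatMap B js) noColumns
placements-by-columns B inB []       _           (suc r) = refl
placements-by-columns B inB (j ∷ js) (j∉js ∷ u) (suc r) =
  trans (placements-column j (B j) (concatMap B js) noColumns (inB j) outside refl r)
        (cong₂ _+_ (placements-by-columns B inB js u (suc r))
                   (cong (length (B j) *_) (placements-by-columns B inB js u r)))
  where
  outside : All (λ s → j ≢ col s) (concatMap B js)
  outside = concat⁺ (map⁺ (All-map (λ {k} j≢k → All-map (λ s≡k j≡s → j≢k (trans j≡s s≡k)) (inB k)) j∉js))

-- The shaded columns of the board

filter-concatMap : {A B : Set} (b : B → Bool) (f : A → List B) (xs : List A) →
                   filter (λ y → T? (b y)) (concatMap f xs) ≡ concatMap (λ x → filter (λ y → T? (b y)) (f x)) xs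
filter-concatMap b f []       = refl
filter-concatMap b f (x ∷ xs) =
  trans (filter-++ (λ y → T? (b y)) (f x) (concatMap f xs)) (cong (_ ++_) (filter-concatMap b f xs))

shadedColumn : ℕ → ℕ → List Square
shadedColumn n j = filter (λ s → T? (shaded n s)) (applyUpTo (λ i → (suc i , j)) (n ∸ j))

shadedSquares-by-columns : ∀ n → shadedSquares n ≡ concatMap (shadedColumn n) (applyUpTo suc (n ∸ 1))
shadedSquares-by-columns n = filter-concatMap (shaded n) (λ j → applyUpTo (λ i → (suc i , j)) (n ∸ j)) (applyUpTo suc (n ∸ 1))

shadedColumn-in-column : ∀ n j → All (λ s → col s ≡ j) (shadedColumn n j)
shadedColumn-in-column n j = filter⁺ _ (applyUpTo⁺₂ _ (n ∸ j) (λ i → refl))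

columns-distinct : ∀ m → Unique (applyUpTo suc m)
columns-distinct m = applyUpTo⁺₁ suc m (λ i<j _ si≡sj → <-irrefl (suc-injective si≡sj) i<j)

isEven : ℕ → Bool
isEven m = m % 2 ≡ᵇ 0

isEven-+2 : ∀ m → isEven (suc (suc m)) ≡ isEven m
isEven-+2 m = cong (_≡ᵇ 0) (trans (cong (_% 2) (+-comm 2 m)) ([m+n]%n≡m%n m 2))

⌈suc/2⌉ : ∀ m → ⌈ suc m /2⌉ ≡ (if isEven m then suc ⌈ m /2⌉ else ⌈ m /2⌉)
⌈suc/2⌉ zero          = refl
⌈suc/2⌉ (suc zero)    = refl
⌈suc/2⌉ (suc (suc m)) = begin
  suc ⌈ suc m /2⌉
    ≡⟨ cong suc (⌈suc/2⌉ m) ⟩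
  suc (if isEven m then suc ⌈ m /2⌉ else ⌈ m /2⌉)
    ≡⟨ if-float suc (isEven m) ⟩
  (if isEven m then suc (suc ⌈ m /2⌉) else suc ⌈ m /2⌉)
    ≡⟨ cong (λ b → if b then suc (suc ⌈ m /2⌉) else suc ⌈ m /2⌉) (sym (isEven-+2 m)) ⟩
  (if isEven (suc (suc m)) then suc ⌈ suc (suc m) /2⌉ else ⌈ suc (suc m) /2⌉) ∎

evens-below : ∀ m → count isEven (applyUpTo (λ i → m ∸ suc i) m) ≡ ⌈ m /2⌉
evens-below zero    = refl
evens-below (suc m) = trans (cong (λ c → if isEven m then suc c else c) (evens-below m)) (sym (⌈suc/2⌉ m))

∸-swap : ∀ n a b → n ∸ a ∸ b ≡ n ∸ b ∸ a
∸-swap n a b = trans (∸-+-assoc n a b) (trans (cong (n ∸_) (+-comm a b)) (sym (∸-+-assoc n b a)))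

-- Column j has ⌈(n-j)/2⌉ shaded squares, as (i+1, j) is shaded iff (n-j) - (i+1) is even.
length-shadedColumn : ∀ n j → length (shadedColumn n j) ≡ ⌈ (n ∸ j) /2⌉
length-shadedColumn n j = begin
  length (shadedColumn n j)
    ≡⟨ length-filter≡count (shaded n) (applyUpTo (λ i → (suc i , j)) (n ∸ j)) ⟩
  count (shaded n) (applyUpTo (λ i → (suc i , j)) (n ∸ j))
    ≡⟨ count-applyUpTo _ _ (λ i → cong isEven (∸-swap n (suc i) j)) (n ∸ j) ⟩
  count isEven (applyUpTo (λ i → n ∸ j ∸ suc i) (n ∸ j))
    ≡⟨ evens-below (n ∸ j) ⟩
  ⌈ (n ∸ j) /2⌉ ∎

-- halfCeils k = ⌈k/2⌉, ⌈(k-1)/2⌉, …, ⌈1/2⌉ : the column sizes of the board of length k+1.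
halfCeils : ℕ → List ℕ
halfCeils = applyDownFrom (λ i → ⌈ suc i /2⌉)

applyUpTo-reverse : ∀ (f : ℕ → ℕ) m → applyUpTo (λ i → f (m ∸ i)) m ≡ applyDownFrom (λ i → f (suc i)) m
applyUpTo-reverse f zero    = refl
applyUpTo-reverse f (suc m) = cong (f (suc m) ∷_) (applyUpTo-reverse f m)

column-sizes : ∀ n → map (λ j → length (shadedColumn n j)) (applyUpTo suc (n ∸ 1)) ≡ halfCeils (n ∸ 1)
column-sizes n = trans (map-cong (length-shadedColumn n) _) (trans (map-applyUpTo suc _ (n ∸ 1)) (reversed n))
  where
  reversed : ∀ n → applyUpTo (λ i → ⌈ (n ∸ suc i) /2⌉) (n ∸ 1) ≡ halfCeils (n ∸ 1)
  reversed zero    = refl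
  reversed (suc k) = applyUpTo-reverse ⌈_/2⌉ k

length-AR : ∀ n r → length (AR n r) ≡ e r (halfCeils (n ∸ 1))
length-AR n r = begin
  length (AR n r)
    ≡⟨ length-filter≡count (λ p → (length p ≡ᵇ r) ∧ distinctCols p) (subsets (shadedSquares n)) ⟩
  count (λ p → (length p ≡ᵇ r) ∧ distinctCols p) (subsets (shadedSquares n))
    ≡⟨ count-cong (λ p → cong ((length p ≡ᵇ r) ∧_) (sym (cong (_∧ distinctCols p) (avoids-noColumns p)))) (subsets (shadedSquares n)) ⟩
  placements (shadedSquares n) r noColumns
    ≡⟨ cong (λ L → placements L r noColumns) (shadedSquares-by-columns n) ⟩
  placements (concatMap (shadedColumn n) (applyUpTo suc (n ∸ 1))) r noColumns
    ≡⟨ placements-by-columns (shadedColumn n) (shadedColumn-in-column n) _ (columns-distinct (n ∸ 1)) r ⟩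
  e r (map (λ j → length (shadedColumn n j)) (applyUpTo suc (n ∸ 1)))
    ≡⟨ cong (e r) (column-sizes n) ⟩
  e r (halfCeils (n ∸ 1)) ∎

⌊double/2⌋ : ∀ q → ⌊ q * 2 /2⌋ ≡ q
⌊double/2⌋ zero    = refl
⌊double/2⌋ (suc q) = cong suc (⌊double/2⌋ q)

⌈double/2⌉ : ∀ q → ⌈ q * 2 /2⌉ ≡ q
⌈double/2⌉ zero    = refl
⌈double/2⌉ (suc q) = cong suc (⌈double/2⌉ q)

-- ⌈2q/2⌉ ⋯ ⌈1/2⌉ = (q q)(q-1 q-1) ⋯ (1 1) = q!².
product-halfCeils-even : ∀ q → product (halfCeils (q * 2)) ≡ q ! * q !
product-halfCeils-even zero    = refl
product-halfCeils-even (suc p) = begin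
  ⌈ suc (suc (p * 2)) /2⌉ * (⌈ suc (p * 2) /2⌉ * product (halfCeils (p * 2)))
    ≡⟨ cong₂ (λ a b → a * (b * product (halfCeils (p * 2)))) (cong suc (⌈double/2⌉ p)) (cong suc (⌊double/2⌋ p)) ⟩
  suc p * (suc p * product (halfCeils (p * 2)))
    ≡⟨ cong (λ x → suc p * (suc p * x)) (product-halfCeils-even p) ⟩
  suc p * (suc p * (p ! * p !))
    ≡⟨ interchange (suc p) (p !) ⟩
  suc p ! * suc p ! ∎
  where
  interchange : ∀ a b → a * (a * (b * b)) ≡ (a * b) * (a * b)
  interchange = solve-∀

product-halfCeils-odd : ∀ q → product (halfCeils (suc (q * 2))) ≡ suc q * (q ! * q !)
product-halfCeils-odd q = cong₂ _*_ (cong suc (⌊double/2⌋ q)) (product-halfCeils-even q)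

sum-halfCeils : ∀ k → sum (halfCeils k) ≡ ⌊ suc k /2⌋ * ⌈ suc k /2⌉
sum-halfCeils zero    = refl
sum-halfCeils (suc k) = begin
  c + sum (halfCeils k)   ≡⟨ cong (c +_) (sum-halfCeils k) ⟩
  c + f * c               ≡⟨ cong (c +_) (*-comm f c) ⟩
  c + c * f               ≡⟨ sym (*-suc c f) ⟩
  c * suc f               ∎
  where
  c = ⌈ suc k /2⌉
  f = ⌊ suc k /2⌋

-- ∏ (1 + ⌈m/2⌉) over m ≤ k equals ∏ ⌈m/2⌉ over m ≤ k + 2, since ⌈1/2⌉ = ⌈2/2⌉ = 1.
product-shifted-halfCeils : ∀ k → product (map suc (halfCeils k)) ≡ product (halfCeils (suc (suc k)))
product-shifted-halfCeils zero    = refl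
product-shifted-halfCeils (suc k) = cong (suc ⌈ suc k /2⌉ *_) (product-shifted-halfCeils k)

d-via-e : ∀ n k → k ≤ n → d n k ≡ e (n ∸ k) (halfCeils (n ∸ 1))
d-via-e n k k≤n rewrite Equivalence.to T-≡ (≤⇒≤ᵇ k≤n) = length-AR n (n ∸ k)

-- d(m+1, 1) places m rooks on the m columns: one in each.
d-one : ∀ m → d (suc m) 1 ≡ product (halfCeils m)
d-one m = begin
  d (suc m) 1                           ≡⟨ d-via-e (suc m) 1 (s≤s z≤n) ⟩
  e m (halfCeils m)                     ≡⟨ cong (λ r → e r (halfCeils m)) (sym (length-applyDownFrom _ m)) ⟩
  e (length (halfCeils m)) (halfCeils m) ≡⟨ e-length (halfCeils m) ⟩
  product (halfCeils m)                 ∎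

d-one-odd : ∀ n q → n ≡ suc (q * 2) → d n 1 ≡ ((n ∸ 1) / 2) ! * ((n ∸ 1) / 2) !
d-one-odd _ q refl =
  trans (d-one (q * 2)) (trans (product-halfCeils-even q) (cong (λ x → x ! * x !) (sym (m*n/n≡m q 2))))

d-one-even : ∀ n q → 1 ≤ n → n ≡ q * 2 → d n 1 ≡ (n / 2) * (((n ∸ 2) / 2) ! * ((n ∸ 2) / 2) !)
d-one-even (suc _) zero    _ ()
d-one-even _       (suc p) _ refl =
  trans (d-one (suc (p * 2)))
        (trans (product-halfCeils-odd p)
               (cong₂ (λ a b → a * (b ! * b !)) (sym (m*n/n≡m (suc p) 2)) (sym (m*n/n≡m p 2))))

-- d(n, n-1) places a single rook.
d-single-rook : ∀ n → 1 ≤ n → d n (n ∸ 1) ≡ ⌊ n /2⌋ * ⌈ n /2⌉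
d-single-rook (suc k) _ = begin
  d (suc k) k                  ≡⟨ d-via-e (suc k) k (n≤1+n k) ⟩
  e (suc k ∸ k) (halfCeils k)  ≡⟨ cong (λ r → e r (halfCeils k)) (m+n∸n≡m 1 k) ⟩
  e 1 (halfCeils k)            ≡⟨ e-one (halfCeils k) ⟩
  sum (halfCeils k)            ≡⟨ sum-halfCeils k ⟩
  ⌊ suc k /2⌋ * ⌈ suc k /2⌉    ∎

r-formula : ∀ n → r n ≡ d (n + 2) 1
r-formula n = begin
  sumUpTo n (d n)                      ≡⟨ sumUpTo-cong n _ _ (d-via-e n) ⟩
  sumUpTo n (λ k → e (n ∸ k) L)         ≡⟨ sumUpTo-reverse n (λ r → e r L) ⟩
  sumUpTo n (λ r → e r L)               ≡⟨ sum-e L n (subst (_≤ n) (sym (length-applyDownFrom _ (n ∸ 1))) (m∸n≤m n 1)) ⟩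
  product (map suc L)                   ≡⟨ shifted n ⟩
  product (halfCeils (suc n))           ≡⟨ sym (d-one (suc n)) ⟩
  d (suc (suc n)) 1                     ≡⟨ cong (λ m → d m 1) (+-comm 2 n) ⟩
  d (n + 2) 1                           ∎
  where
  L = halfCeils (n ∸ 1)
  shifted : ∀ n → product (map suc (halfCeils (n ∸ 1))) ≡ product (halfCeils (suc n))
  shifted zero    = refl
  shifted (suc m) = product-shifted-halfCeils m

proposition7p7 : ((n : ℕ) → 1 ≤ n →
                    (n % 2 ≡ 1 → d n 1 ≡ ((n ∸ 1) / 2) ! * ((n ∸ 1) / 2) !)
                  × (n % 2 ≡ 0 → d n 1 ≡ (n / 2) * (((n ∸ 2) / 2) ! * ((n ∸ 2) / 2) !))
                  × (d n (n ∸ 1) ≡ ⌊ n /2⌋ * ⌈ n /2⌉))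
               × ((n : ℕ) → r n ≡ d (n + 2) 1)
proposition7p7 = (λ n 1≤n → odd-case n , even-case n 1≤n , d-single-rook n 1≤n) , r-formula
  where
  odd-case : ∀ n → n % 2 ≡ 1 → d n 1 ≡ ((n ∸ 1) / 2) ! * ((n ∸ 1) / 2) !
  odd-case n odd = d-one-odd n (n / 2) (trans (m≡m%n+[m/n]*n n 2) (cong (_+ n / 2 * 2) odd))
  even-case : ∀ n → 1 ≤ n → n % 2 ≡ 0 → d n 1 ≡ (n / 2) * (((n ∸ 2) / 2) ! * ((n ∸ 2) / 2) !)
  even-case n 1≤n even = d-one-even n (n / 2) 1≤n (trans (m≡m%n+[m/n]*n n 2) (cong (_+ n / 2 * 2) even))
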